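{- Let $\mathcal R=\{R_1,\ldots,R_k\}$ be a row-division of a matrix $M$ and $C$ a set of consecutive columns of $M$. Merging two consecutive parts $R_i,R_{i+1}$ of $\mathcal R$ into one part does not increase the mixed value of $C$ on $\mathcal R$.
   Context: A row-division of $M$ is a partition $\mathcal R=\{R_1,\ldots,R_k\}$ of its rows into sets of consecutive rows, with $R_1,\ldots,R_k$ ordered from top to bottom. A matrix $(m_{i,j})$ is vertical if $m_{i,j}=m_{i+1,j}$ for all $i,j$, horizontal if $m_{i,j}=m_{i,j+1}$ for all $i,j$, and mixed if neither. A mixed zone of $C$ on $\mathcal R$ is a submatrix $R_i\cap C$ (rows of $R_i$, columns of $C$) that is mixed. A mixed cut of $C$ on $\mathcal R$ is an index $i\in[k-1]$ such that the $2\times|C|$ submatrix formed by the last row of $R_i$ and the first row of $R_{i+1}$, restricted to the columns of $C$, is mixed. The mixed value of $C$ on $\mathcal R$ is the number of mixed cuts plus the number of mixed zones. -}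

module Defs where

open import Level using (Level)
open import Data.Nat using (ℕ; zero; suc; _+_; _≤_; _<_; s≤s; z≤n)
open import Data.Nat.Properties using (+-monoʳ-<; +-monoʳ-≤; +-comm; +-assoc; ≤-trans; m≤m+n; ≤-reflexive; +-suc; _≟_)
open import Data.Fin using (Fin; toℕ; fromℕ<)
open import Data.Fin.Properties using (all?; toℕ<n)
open import Data.List using (List; []; _∷_; length)
open import Data.Nat.ListAction using (sum)
open import Data.List.Relation.Unary.All using (All; []; _∷_)
open import Data.Product using (_×_; _,_)
open import Relation.Nullary using (¬_; Dec; does)
open import Relation.Nullary.Decidable using (_→-dec_; _×-dec_; ¬?)
open import Relation.Binary.Definitions using (DecidableEquality)
open import Relation.Binary.PropositionalEquality using (_≡_; refl; sym; cong; subst)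
import Relation.Binary.PropositionalEquality
open import Data.Bool using (if_then_else_)

Matrix : Set → ℕ → ℕ → Set
Matrix A h w = Fin h → Fin w → A

Vertical : {A : Set} {h w : ℕ} → Matrix A h w → Set
Vertical {h = h} {w} N = ∀ (i i' : Fin h) (j : Fin w) → suc (toℕ i) ≡ toℕ i' → N i j ≡ N i' j

Horizontal : {A : Set} {h w : ℕ} → Matrix A h w → Set
Horizontal {h = h} {w} N = ∀ (i : Fin h) (j j' : Fin w) → suc (toℕ j) ≡ toℕ j' → N i j ≡ N i j'

Mixed : {A : Set} {h w : ℕ} → Matrix A h w → Set
Mixed N = ¬ Vertical N × ¬ Horizontal N

vertical? : {A : Set} {h w : ℕ} → DecidableEquality A → (N : Matrix A h w) → Dec (Vertical N)
vertical? _≟A_ N = all? λ i → all? λ i' → all? λ j → (suc (toℕ i) ≟ toℕ i') →-dec (N i j ≟A N i' j)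

horizontal? : {A : Set} {h w : ℕ} → DecidableEquality A → (N : Matrix A h w) → Dec (Horizontal N)
horizontal? _≟A_ N = all? λ i → all? λ j → all? λ j' → (suc (toℕ j) ≟ toℕ j') →-dec (N i j ≟A N i j')

mixed? : {A : Set} {h w : ℕ} → DecidableEquality A → (N : Matrix A h w) → Dec (Mixed N)
mixed? eq N = ¬? (vertical? eq N) ×-dec ¬? (horizontal? eq N)

[mixed] : {A : Set} {h w : ℕ} → DecidableEquality A → Matrix A h w → ℕ
[mixed] eq N = if does (mixed? eq N) then 1 else 0

shift< : {r h m : ℕ} (i : Fin h) → r + h ≤ m → r + toℕ i < m
shift< {r} i p = ≤-trans (+-monoʳ-< r (toℕ<n i)) p

sub : {A : Set} {m n : ℕ} → Matrix A m n →
      (r h : ℕ) → r + h ≤ m → (c w : ℕ) → c + w ≤ n → Matrix A h w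
sub M r h pr c w pc i j = M (fromℕ< (shift< i pr)) (fromℕ< (shift< j pc))

record ColInterval (n : ℕ) : Set where
  constructor colInterval
  field
    start  : ℕ
    width  : ℕ
    nonempty : 1 ≤ width
    bound  : start + width ≤ n
open ColInterval public

-- A row-division of the m rows: parts R_1, …, R_k listed top to bottom by their
-- (positive) sizes, which sum to m.  Part R_i consists of consecutive rows.
record RowDivision (m : ℕ) : Set where
  constructor rowDivision
  field
    sizes    : List ℕ
    positive : All (λ l → 1 ≤ l) sizes
    total    : sum sizes ≡ m
open RowDivision public

private
  lem₁ : ∀ r a b → r + (a + b) ≡ (r + a) + b
  lem₁ r a b = sym (+-assoc r a b)

  -- rows r+l0 and r+l0+1 fit when the next part is nonempty
  cutBound : ∀ {m} r l0 l' s → r + (suc l0 + (suc l' + s)) ≤ m → (r + l0) + 2 ≤ m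
  cutBound {m} r l0 l' s p = ≤-trans q p
    where
    q : (r + l0) + 2 ≤ r + (suc l0 + (suc l' + s))
    q = ≤-trans (≤-reflexive (+-assoc r l0 2))
          (+-monoʳ-≤ r (≤-trans (+-monoʳ-≤ l0 (s≤s (s≤s z≤n)))
                                (≤-reflexive (+-suc l0 (suc (l' + s))))))

-- Mixed value of the columns [c, c+w) on the parts listed by ls, the first of which
-- starts at row r: number of mixed zones plus number of mixed cuts.
mixedValueFrom : {A : Set} {m n : ℕ} → DecidableEquality A → Matrix A m n →
                 (c w : ℕ) → c + w ≤ n →
                 (r : ℕ) (ls : List ℕ) → All (λ l → 1 ≤ l) ls → r + sum ls ≤ m → ℕ
mixedValueFrom eq M c w pc r [] _ _ = 0
mixedValueFrom eq M c w pc r (l ∷ []) _ p =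
  [mixed] eq (sub M r l (≤-trans (≤-reflexive (sym (cong (r +_) (+-comm l 0)))) p) c w pc)
mixedValueFrom eq M c w pc r (suc l0 ∷ suc l' ∷ ls) (s≤s z≤n ∷ s≤s z≤n ∷ ps) p =
    [mixed] eq (sub M r (suc l0) (≤-trans (+-monoʳ-≤ r (m≤m+n (suc l0) (suc l' + sum ls))) p) c w pc)
  + [mixed] eq (sub M (r + l0) 2 (cutBound r l0 l' (sum ls) p) c w pc)
  + mixedValueFrom eq M c w pc (r + suc l0) (suc l' ∷ ls) (s≤s z≤n ∷ ps)
      (≤-trans (≤-reflexive (sym (lem₁ r (suc l0) (suc l' + sum ls)))) p)

mixedValue : {A : Set} {m n : ℕ} → DecidableEquality A → Matrix A m n →
             ColInterval n → RowDivision m → ℕ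
mixedValue eq M C D =
  mixedValueFrom eq M (start C) (width C) (bound C) 0 (sizes D) (positive D) (≤-reflexive (total D))

-- Merging the parts R_{i+1} and R_{i+2} (0-based index i) of a list of sizes.
mergeAt : ℕ → List ℕ → List ℕ
mergeAt zero (a ∷ b ∷ ls) = (a + b) ∷ ls
mergeAt (suc i) (a ∷ ls) = a ∷ mergeAt i ls
mergeAt _ ls = ls

mergeAt-positive : ∀ i ls → All (λ l → 1 ≤ l) ls → All (λ l → 1 ≤ l) (mergeAt i ls)
mergeAt-positive zero (a ∷ b ∷ ls) (pa ∷ pb ∷ ps) = ≤-trans pa (m≤m+n a b) ∷ ps
mergeAt-positive zero [] ps = ps
mergeAt-positive zero (a ∷ []) ps = ps
mergeAt-positive (suc i) [] ps = ps
mergeAt-positive (suc i) (a ∷ ls) (pa ∷ ps) = pa ∷ mergeAt-positive i ls ps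

mergeAt-sum : ∀ i ls → sum (mergeAt i ls) ≡ sum ls
mergeAt-sum zero (a ∷ b ∷ ls) = +-assoc a b (sum ls)
mergeAt-sum zero [] = refl
mergeAt-sum zero (a ∷ []) = refl
mergeAt-sum (suc i) [] = refl
mergeAt-sum (suc i) (a ∷ ls) = cong (a +_) (mergeAt-sum i ls)

-- The row-division obtained from D by merging its consecutive parts
-- R_{i+1} and R_{i+2} (0-based i; meaningful when i + 1 < number of parts).
mergeDivision : {m : ℕ} → ℕ → RowDivision m → RowDivision m
mergeDivision i D = rowDivision (mergeAt i (sizes D)) (mergeAt-positive i (sizes D) (positive D))
  (Relation.Binary.PropositionalEquality.trans (mergeAt-sum i (sizes D)) (total D))

module Submission where

-- A merged part together with the cut inside it is non-mixed as soon as both old parts and the cut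
-- are. A horizontal cut makes its two rows constant; in a non-mixed part one constant row makes every
-- row constant (a vertical part has all rows equal), so both parts and hence their union are
-- horizontal. A vertical cut equates its two rows, so a constant row still crosses the boundary,
-- and if both parts are vertical the union is vertical. Hence the zone of the merged part costs at
-- most the two old zones plus the old cut, while every other zone and cut is unchanged.

open import Defs
open import Data.Nat using (ℕ; zero; suc; pred; _+_; _≤_; _<_; s≤s; z≤n; _≤?_; _<?_)
open import Data.Nat.Properties
  using (≤-refl; ≤-trans; ≤-reflexive; <-trans; n<1+n; m≤m+n; +-monoʳ-≤; +-monoˡ-≤;
         +-assoc; +-comm; +-suc; +-identityʳ; module ≤-Reasoning)
open import Data.Fin using (Fin; toℕ; fromℕ<) renaming (zero to fzero)
open import Data.Fin.Properties using (toℕ-fromℕ<; toℕ<n)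
open import Data.List using (List; []; _∷_; length)
open import Data.Nat.ListAction using (sum)
open import Data.List.Relation.Unary.All using (All; []; _∷_)
open import Data.Product using (_×_; _,_; ∃-syntax)
open import Data.Sum using (_⊎_; inj₁; inj₂)
open import Data.Empty using (⊥-elim)
open import Data.Bool using (if_then_else_)
open import Relation.Nullary using (¬_; Dec; yes; no; does; contradiction)
open import Relation.Binary.Definitions using (DecidableEquality)
open import Relation.Binary.PropositionalEquality
  using (_≡_; _≗_; refl; sym; trans; cong; cong₂; subst)

<-split : ∀ a {b t} → t < a + b → t < a ⊎ ∃[ u ] u < b × u + a ≡ t
<-split zero    {t = t}     t<b       = inj₂ (t , t<b , +-identityʳ t)
<-split (suc a) {t = zero}  _         = inj₁ (s≤s z≤n)
<-split (suc a) {t = suc t} (s≤s t<) with <-split a t<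
... | inj₁ t<a             = inj₁ (s≤s t<a)
... | inj₂ (u , u<b , u+a) = inj₂ (u , u<b , trans (+-suc u a) (cong suc u+a))

indicator-≤₃ : ∀ {P Q R S : Set} (p : Dec P) (q : Dec Q) (r : Dec R) (s : Dec S) →
               (¬ P → ¬ Q → ¬ R → ¬ S) →
               (if does s then 1 else 0) ≤
                 (if does p then 1 else 0) + ((if does q then 1 else 0) + (if does r then 1 else 0))
indicator-≤₃ _       _       _       (no _)  _ = z≤n
indicator-≤₃ (yes _) _       _       (yes _) _ = s≤s z≤n
indicator-≤₃ (no _)  (yes _) _       (yes _) _ = s≤s z≤n
indicator-≤₃ (no _)  (no _)  (yes _) (yes _) _ = s≤s z≤n
indicator-≤₃ (no ¬p) (no ¬q) (no ¬r) (yes s) ¬S = ⊥-elim (¬S ¬p ¬q ¬r s)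

¬mixed⇒vertical⊎horizontal : {A : Set} {h w : ℕ} → DecidableEquality A → (N : Matrix A h w) →
                             ¬ Mixed N → Vertical N ⊎ Horizontal N
¬mixed⇒vertical⊎horizontal eq N ¬mixed with vertical? eq N | horizontal? eq N
... | yes vertical | _             = inj₁ vertical
... | no _         | yes horizontal = inj₂ horizontal
... | no ¬vertical | no ¬horizontal = ⊥-elim (¬mixed (¬vertical , ¬horizontal))

-- A block of h rows is a sequence β of rows of which only β 0, …, β (h - 1) matter; shifting blocks
-- and splitting row ranges is then plain arithmetic on ℕ.
module RowSequence {A : Set} {w : ℕ} where

  ConstantRow : (Fin w → A) → Set
  ConstantRow ρ = ∀ (j j' : Fin w) → suc (toℕ j) ≡ toℕ j' → ρ j ≡ ρ j'

  VerticalRows : (ℕ → Fin w → A) → ℕ → Set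
  VerticalRows β h = ∀ t → suc t < h → β t ≗ β (suc t)

  HorizontalRows : (ℕ → Fin w → A) → ℕ → Set
  HorizontalRows β h = ∀ t → t < h → ConstantRow (β t)

  NotMixedRows : (ℕ → Fin w → A) → ℕ → Set
  NotMixedRows β h = VerticalRows β h ⊎ HorizontalRows β h

  constantRow-≗ : ∀ {ρ σ} → ρ ≗ σ → ConstantRow ρ → ConstantRow σ
  constantRow-≗ ρ≗σ const j j' j+1≡j' = trans (sym (ρ≗σ j)) (trans (const j j' j+1≡j') (ρ≗σ j'))

  verticalRows⇒≗head : ∀ {β h} → VerticalRows β h → ∀ t → t < h → β 0 ≗ β t
  verticalRows⇒≗head vertical zero    _   j = refl
  verticalRows⇒≗head vertical (suc t) t<h j =
    trans (verticalRows⇒≗head vertical t (<-trans (n<1+n t) t<h) j) (vertical t t<h j)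

  constantRow⇒horizontalRows : ∀ {β h t} → NotMixedRows β h → t < h → ConstantRow (β t) →
                               HorizontalRows β h
  constantRow⇒horizontalRows (inj₂ horizontal) _ _ = horizontal
  constantRow⇒horizontalRows {t = t} (inj₁ vertical) t<h const u u<h =
    constantRow-≗ (λ j → trans (sym (verticalRows⇒≗head vertical t t<h j)) (verticalRows⇒≗head vertical u u<h j)) const

  horizontalRows-glue : ∀ {β a b} → HorizontalRows β a → HorizontalRows (λ t → β (t + a)) b →
                        HorizontalRows β (a + b)
  horizontalRows-glue {β} {a} top bottom t t<a+b with <-split a t<a+b
  ... | inj₁ t<a             = top t t<a
  ... | inj₂ (u , u<b , u+a) = subst (λ k → ConstantRow (β k)) u+a (bottom u u<b)

  verticalRows-glue : ∀ {β a b} → VerticalRows β (suc a) → β a ≗ β (suc a) →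
                      VerticalRows (λ t → β (t + suc a)) b → VerticalRows β (suc a + b)
  verticalRows-glue {a = a} top cut bottom t t+1< with <-split (suc a) t+1<
  ... | inj₁ t+1<                   = top t t+1<
  ... | inj₂ (zero , _ , refl)      = cut
  ... | inj₂ (suc u , u+1<b , refl) = bottom u u+1<b

  horizontalRows-glue-at : ∀ {β a b} → NotMixedRows β (suc a) → NotMixedRows (λ t → β (t + suc a)) (suc b) →
                           ConstantRow (β a) → ConstantRow (β (suc a)) → HorizontalRows β (suc a + suc b)
  horizontalRows-glue-at top bottom constₐ constₐ₊₁ =
    horizontalRows-glue (constantRow⇒horizontalRows top ≤-refl constₐ)
                        (constantRow⇒horizontalRows bottom (s≤s z≤n) constₐ₊₁)

  notMixedRows-glue : ∀ β a b → NotMixedRows β (suc a) → NotMixedRows (λ t → β (t + a)) 2 →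
                      NotMixedRows (λ t → β (t + suc a)) (suc b) → NotMixedRows β (suc a + suc b)
  notMixedRows-glue β a b top (inj₂ cut) bottom =
    inj₂ (horizontalRows-glue-at top bottom (cut 0 (s≤s z≤n)) (cut 1 ≤-refl))
  notMixedRows-glue β a b (inj₂ top) (inj₁ cut) bottom =
    inj₂ (horizontalRows-glue-at (inj₂ top) bottom (top a ≤-refl) (constantRow-≗ (cut 0 ≤-refl) (top a ≤-refl)))
  notMixedRows-glue β a b (inj₁ top) (inj₁ cut) (inj₂ bottom) =
    inj₂ (horizontalRows-glue-at (inj₁ top) (inj₂ bottom)
           (constantRow-≗ (λ j → sym (cut 0 ≤-refl j)) (bottom 0 (s≤s z≤n))) (bottom 0 (s≤s z≤n)))
  notMixedRows-glue β a b (inj₁ top) (inj₁ cut) (inj₁ bottom) =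
    inj₁ (verticalRows-glue top (cut 0 ≤-refl) bottom)

  module _ {h : ℕ} (N : Matrix A h w) (β : ℕ → Fin w → A) (N≡β : ∀ i j → N i j ≡ β (toℕ i) j) where

    private
      N-fromℕ< : ∀ {t} (t<h : t < h) j → N (fromℕ< t<h) j ≡ β t j
      N-fromℕ< t<h j = trans (N≡β _ j) (cong (λ k → β k j) (toℕ-fromℕ< t<h))

    vertical⇒verticalRows : Vertical N → VerticalRows β h
    vertical⇒verticalRows vertical t t+1<h j =
      trans (sym (N-fromℕ< t<h j))
            (trans (vertical _ _ j (trans (cong suc (toℕ-fromℕ< t<h)) (sym (toℕ-fromℕ< t+1<h))))
                   (N-fromℕ< t+1<h j))
      where
      t<h : t < h
      t<h = <-trans (n<1+n t) t+1<h

    verticalRows⇒vertical : VerticalRows β h → Vertical N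
    verticalRows⇒vertical vertical i i' j i+1≡i' =
      trans (N≡β i j)
            (trans (vertical (toℕ i) (subst (_< h) (sym i+1≡i') (toℕ<n i')) j)
                   (trans (cong (λ k → β k j) i+1≡i') (sym (N≡β i' j))))

    horizontal⇒horizontalRows : Horizontal N → HorizontalRows β h
    horizontal⇒horizontalRows horizontal t t<h j j' j+1≡j' =
      trans (sym (N-fromℕ< t<h j)) (trans (horizontal _ j j' j+1≡j') (N-fromℕ< t<h j'))

    horizontalRows⇒horizontal : HorizontalRows β h → Horizontal N
    horizontalRows⇒horizontal horizontal i j j' j+1≡j' =
      trans (N≡β i j) (trans (horizontal (toℕ i) (toℕ<n i) j j' j+1≡j') (sym (N≡β i j')))

    ¬mixed⇒notMixedRows : DecidableEquality A → ¬ Mixed N → NotMixedRows β h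
    ¬mixed⇒notMixedRows eq ¬mixed with ¬mixed⇒vertical⊎horizontal eq N ¬mixed
    ... | inj₁ vertical   = inj₁ (vertical⇒verticalRows vertical)
    ... | inj₂ horizontal = inj₂ (horizontal⇒horizontalRows horizontal)

    notMixedRows⇒¬mixed : NotMixedRows β h → ¬ Mixed N
    notMixedRows⇒¬mixed (inj₁ vertical)   (¬vertical , _) = ¬vertical (verticalRows⇒vertical vertical)
    notMixedRows⇒¬mixed (inj₂ horizontal) (_ , ¬horizontal) = ¬horizontal (horizontalRows⇒horizontal horizontal)

module MixedValue {A : Set} (_≟A_ : DecidableEquality A) {m n : ℕ} (M : Matrix A m n)
                  (c w : ℕ) (pc : c + w ≤ n) where
  open RowSequence

  -- Rows k ≥ m do not exist and are filled with the junk row ρ₀.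
  rowOf : (Fin w → A) → ℕ → Fin w → A
  rowOf ρ₀ k with k <? m
  ... | yes k<m = λ j → M (fromℕ< k<m) (fromℕ< (shift< j pc))
  ... | no _    = ρ₀

  sub≡rowOf : ∀ ρ₀ {r h} (pr : r + h ≤ m) i j {k} → r + toℕ i ≡ k → sub M r h pr c w pc i j ≡ rowOf ρ₀ k j
  sub≡rowOf ρ₀ {r} pr i j refl with r + toℕ i <? m
  ... | yes _   = refl
  ... | no k≮m = contradiction (shift< i pr) k≮m

  ¬mixed-glue : ∀ r a b (pN : r + (suc a + suc b) ≤ m) (p₁ : r + suc a ≤ m) (pcut : r + a + 2 ≤ m)
                (p₂ : suc (r + a) + suc b ≤ m) →
                ¬ Mixed (sub M r (suc a) p₁ c w pc) → ¬ Mixed (sub M (r + a) 2 pcut c w pc) →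
                ¬ Mixed (sub M (suc (r + a)) (suc b) p₂ c w pc) →
                ¬ Mixed (sub M r (suc a + suc b) pN c w pc)
  ¬mixed-glue r a b pN p₁ pcut p₂ ¬top ¬cut ¬bottom =
    notMixedRows⇒¬mixed _ β (λ i j → sub≡rowOf ρ₀ pN i j refl)
      (notMixedRows-glue β a b
        (¬mixed⇒notMixedRows _ β (λ i j → sub≡rowOf ρ₀ p₁ i j refl) _≟A_ ¬top)
        (¬mixed⇒notMixedRows _ (λ t → β (t + a)) (λ i j → sub≡rowOf ρ₀ pcut i j (shift-cut (toℕ i))) _≟A_ ¬cut)
        (¬mixed⇒notMixedRows _ (λ t → β (t + suc a)) (λ i j → sub≡rowOf ρ₀ p₂ i j (shift-bottom (toℕ i))) _≟A_ ¬bottom))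
    where
    ρ₀ : Fin w → A
    ρ₀ = sub M r (suc a + suc b) pN c w pc fzero
    β : ℕ → Fin w → A
    β t = rowOf ρ₀ (r + t)
    shift-cut : ∀ t → r + a + t ≡ r + (t + a)
    shift-cut t = trans (+-assoc r a t) (cong (r +_) (+-comm a t))
    shift-bottom : ∀ t → suc (r + a) + t ≡ r + (t + suc a)
    shift-bottom t = trans (cong suc (shift-cut t)) (sym (trans (cong (r +_) (+-suc t a)) (+-suc r (t + a))))

  -- Junk value 0 when the block does not fit in M, so that the counting below carries no bound proofs.
  zone : ℕ → ℕ → ℕ
  zone r h with r + h ≤? m
  ... | yes pr = [mixed] _≟A_ (sub M r h pr c w pc)
  ... | no _   = 0

  zone-sub : ∀ r h (pr : r + h ≤ m) → zone r h ≡ [mixed] _≟A_ (sub M r h pr c w pc)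
  zone-sub r h pr with r + h ≤? m
  ... | yes _   = refl
  ... | no ¬pr = contradiction pr ¬pr

  top-fits : ∀ r a b → r + (a + b) ≤ m → r + a ≤ m
  top-fits r a b = ≤-trans (+-monoʳ-≤ r (m≤m+n a b))

  bottom-fits : ∀ r a b → r + (suc a + suc b) ≤ m → suc (r + a) + suc b ≤ m
  bottom-fits r a b = ≤-trans (≤-reflexive (sym (trans (+-suc r (a + suc b)) (cong suc (sym (+-assoc r a (suc b)))))))

  cut-fits : ∀ r a b → r + (suc a + suc b) ≤ m → r + a + 2 ≤ m
  cut-fits r a b pN =
    ≤-trans (+-monoʳ-≤ (r + a) (s≤s (s≤s z≤n))) (≤-trans (≤-reflexive (+-suc (r + a) (suc b))) (bottom-fits r a b pN))

  zone-glue : ∀ r a b → zone r (suc a + suc b) ≤ zone r (suc a) + (zone (r + a) 2 + zone (suc (r + a)) (suc b))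
  zone-glue r a b with r + (suc a + suc b) ≤? m
  ... | no _   = z≤n
  ... | yes pN = begin
      [mixed] _≟A_ (sub M r (suc a + suc b) pN c w pc)
    ≤⟨ indicator-≤₃ (mixed? _≟A_ _) (mixed? _≟A_ _) (mixed? _≟A_ _) (mixed? _≟A_ _)
                    (¬mixed-glue r a b pN p₁ pcut p₂) ⟩
      [mixed] _≟A_ (sub M r (suc a) p₁ c w pc)
        + ([mixed] _≟A_ (sub M (r + a) 2 pcut c w pc) + [mixed] _≟A_ (sub M (suc (r + a)) (suc b) p₂ c w pc))
    ≡⟨ sym (cong₂ _+_ (zone-sub r (suc a) p₁) (cong₂ _+_ (zone-sub (r + a) 2 pcut) (zone-sub (suc (r + a)) (suc b) p₂))) ⟩
      zone r (suc a) + (zone (r + a) 2 + zone (suc (r + a)) (suc b))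
    ∎
    where
    open ≤-Reasoning
    p₁ : r + suc a ≤ m
    p₁ = top-fits r (suc a) (suc b) pN
    pcut : r + a + 2 ≤ m
    pcut = cut-fits r a b pN
    p₂ : suc (r + a) + suc b ≤ m
    p₂ = bottom-fits r a b pN

  -- valueBelow k ls counts the cut between rows k and k + 1 and then the parts of sizes ls from row k + 1 on.
  mutual
    value : ℕ → List ℕ → ℕ
    value r []       = 0
    value r (l ∷ ls) = zone r l + valueBelow (r + pred l) ls

    valueBelow : ℕ → List ℕ → ℕ
    valueBelow k []       = 0
    valueBelow k (l ∷ ls) = zone k 2 + value (suc k) (l ∷ ls)

  mixedValueFrom≡value : ∀ r ls (ps : All (1 ≤_) ls) (p : r + sum ls ≤ m) →
                         mixedValueFrom _≟A_ M c w pc r ls ps p ≡ value r ls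
  mixedValueFrom≡value r [] _ _ = refl
  mixedValueFrom≡value r (l ∷ []) _ p = sym (trans (+-identityʳ (zone r l)) (zone-sub r l (top-fits r l 0 p)))
  mixedValueFrom≡value r (suc l₀ ∷ suc l₁ ∷ ls) (s≤s z≤n ∷ s≤s z≤n ∷ ps) p =
    trans (cong₂ _+_ (cong₂ _+_ (sym (zone-sub r (suc l₀) (top-fits r (suc l₀) _ p)))
                                (sym (zone-sub (r + l₀) 2 (cut-fits r l₀ (l₁ + sum ls) p))))
                     (trans (mixedValueFrom≡value (r + suc l₀) (suc l₁ ∷ ls) (s≤s z≤n ∷ ps) _)
                            (cong (λ k → value k (suc l₁ ∷ ls)) (+-suc r l₀))))
          (+-assoc (zone r (suc l₀)) (zone (r + l₀) 2) (value (suc (r + l₀)) (suc l₁ ∷ ls)))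

  value-merge-head : ∀ r a b ls → value r (suc a + suc b ∷ ls) ≤ value r (suc a ∷ suc b ∷ ls)
  value-merge-head r a b ls = begin
      zone r (suc a + suc b) + valueBelow (r + (a + suc b)) ls
    ≡⟨ cong (λ k → zone r (suc a + suc b) + valueBelow k ls) last-row ⟩
      zone r (suc a + suc b) + rest
    ≤⟨ +-monoˡ-≤ rest (zone-glue r a b) ⟩
      zone r (suc a) + (zone (r + a) 2 + zone (suc (r + a)) (suc b)) + rest
    ≡⟨ +-assoc (zone r (suc a)) _ rest ⟩
      zone r (suc a) + ((zone (r + a) 2 + zone (suc (r + a)) (suc b)) + rest)
    ≡⟨ cong (zone r (suc a) +_) (+-assoc (zone (r + a) 2) (zone (suc (r + a)) (suc b)) rest) ⟩
      zone r (suc a) + (zone (r + a) 2 + (zone (suc (r + a)) (suc b) + rest))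
    ∎
    where
    open ≤-Reasoning
    rest : ℕ
    rest = valueBelow (suc (r + a) + b) ls
    last-row : r + (a + suc b) ≡ suc (r + a) + b
    last-row = trans (cong (r +_) (+-suc a b)) (trans (+-suc r (a + b)) (cong suc (sym (+-assoc r a b))))

  mutual
    value-mergeAt : ∀ i r ls → All (1 ≤_) ls → value r (mergeAt i ls) ≤ value r ls
    value-mergeAt zero    r []                 _                    = ≤-refl
    value-mergeAt zero    r (_ ∷ [])           _                    = ≤-refl
    value-mergeAt zero    r (suc a ∷ suc b ∷ ls) (s≤s z≤n ∷ s≤s z≤n ∷ _) = value-merge-head r a b ls
    value-mergeAt (suc i) r []                 _                    = ≤-refl
    value-mergeAt (suc i) r (l ∷ ls)           (_ ∷ ps)             =
      +-monoʳ-≤ (zone r l) (valueBelow-mergeAt i (r + pred l) ls ps)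

    valueBelow-mergeAt : ∀ i k ls → All (1 ≤_) ls → valueBelow k (mergeAt i ls) ≤ valueBelow k ls
    valueBelow-mergeAt zero    k []            _  = ≤-refl
    valueBelow-mergeAt zero    k (_ ∷ [])      _  = ≤-refl
    valueBelow-mergeAt zero    k (l ∷ l' ∷ ls) ps = +-monoʳ-≤ (zone k 2) (value-mergeAt zero (suc k) (l ∷ l' ∷ ls) ps)
    valueBelow-mergeAt (suc i) k []            _  = ≤-refl
    valueBelow-mergeAt (suc i) k (l ∷ ls)      ps = +-monoʳ-≤ (zone k 2) (value-mergeAt (suc i) (suc k) (l ∷ ls) ps)

lemma5p6 : {A : Set} (_≟A_ : DecidableEquality A) {m n : ℕ}
           (M : Matrix A m n) (C : ColInterval n) (D : RowDivision m)
           (i : ℕ) → suc i < length (sizes D) →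
           mixedValue _≟A_ M C (mergeDivision i D) ≤ mixedValue _≟A_ M C D
lemma5p6 _≟A_ M C D i _ = begin
    mixedValue _≟A_ M C (mergeDivision i D)
  ≡⟨ mixedValueFrom≡value 0 (mergeAt i (sizes D)) _ _ ⟩
    value 0 (mergeAt i (sizes D))
  ≤⟨ value-mergeAt i 0 (sizes D) (positive D) ⟩
    value 0 (sizes D)
  ≡⟨ sym (mixedValueFrom≡value 0 (sizes D) _ _) ⟩
    mixedValue _≟A_ M C D
  ∎
  where
  open MixedValue _≟A_ M (start C) (width C) (bound C)
  open ≤-Reasoning
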